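{- Let $f$ be the morphism on $\{\mathtt{0},\ldots,\mathtt{4}\}^*$ with $f(\mathtt{0})=\mathtt{01203}$, $f(\mathtt{1})=\mathtt{0124}$, $f(\mathtt{2})=\mathtt{0120323}$, $f(\mathtt{3})=\mathtt{01240324}$, $f(\mathtt{4})=\mathtt{01240323}$, and $g:\{\mathtt{0},\ldots,\mathtt{4}\}^*\to\{\mathtt{a},\mathtt{b},\mathtt{c},\mathtt{d},\mathtt{e}\}^*$ the morphism with $g(\mathtt{0})=\mathtt{abcdeacd}$, $g(\mathtt{1})=\mathtt{abcdbecd}$, $g(\mathtt{2})=\mathtt{abcdeacdbe}$, $g(\mathtt{3})=\mathtt{abcdbecdeacdbecd}$, $g(\mathtt{4})=\mathtt{abcdbecdeacdbe}$, and let $w_5=g(f^\omega(\mathtt{0}))$. For $d\ge 0$ let $p_{\mathtt{0324}}=\mathtt{acdbecd}\,g(\mathtt{24}\,f(\mathtt{24})\cdots f^{d-1}(\mathtt{24})\,f^d(\mathtt{24}))$ and $s_{\mathtt{0324}}=g(f^{d-1}(\mathtt{01240})\cdots f(\mathtt{01240})\,\mathtt{01240})\,\mathtt{abcdbecde}$ (the product inside $g$ being empty when $d=0$). Then for every $d\ge 0$, the word $T_{\mathtt{0324}}=p_{\mathtt{0324}}\,g(f^d(\mathtt{0}))\,s_{\mathtt{0324}}$ is a conjugate of $g(f^d(\mathtt{0324}))$ that is not a factor of $w_5$.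
   Context: $f^\omega(\mathtt{0})$ is the infinite fixed point of $f$ starting with $\mathtt{0}$. A conjugate of a word $xy$ is $yx$. -}

module Defs where

open import Data.Nat using (ℕ; zero; suc; _+_)
open import Data.List using (List; []; _∷_; _++_; concatMap; length)
open import Data.Product using (Σ; _×_; ∃)
open import Relation.Binary.PropositionalEquality using (_≡_)

data Digit : Set where
  ⁰ ¹ ² ³ ⁴ : Digit

data Letter : Set where
  a b c d e : Letter

f : Digit → List Digit
f ⁰ = ⁰ ∷ ¹ ∷ ² ∷ ⁰ ∷ ³ ∷ []
f ¹ = ⁰ ∷ ¹ ∷ ² ∷ ⁴ ∷ []
f ² = ⁰ ∷ ¹ ∷ ² ∷ ⁰ ∷ ³ ∷ ² ∷ ³ ∷ []
f ³ = ⁰ ∷ ¹ ∷ ² ∷ ⁴ ∷ ⁰ ∷ ³ ∷ ² ∷ ⁴ ∷ []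
f ⁴ = ⁰ ∷ ¹ ∷ ² ∷ ⁴ ∷ ⁰ ∷ ³ ∷ ² ∷ ³ ∷ []

g : Digit → List Letter
g ⁰ = a ∷ b ∷ c ∷ d ∷ e ∷ a ∷ c ∷ d ∷ []
g ¹ = a ∷ b ∷ c ∷ d ∷ b ∷ e ∷ c ∷ d ∷ []
g ² = a ∷ b ∷ c ∷ d ∷ e ∷ a ∷ c ∷ d ∷ b ∷ e ∷ []
g ³ = a ∷ b ∷ c ∷ d ∷ b ∷ e ∷ c ∷ d ∷ e ∷ a ∷ c ∷ d ∷ b ∷ e ∷ c ∷ d ∷ []
g ⁴ = a ∷ b ∷ c ∷ d ∷ b ∷ e ∷ c ∷ d ∷ e ∷ a ∷ c ∷ d ∷ b ∷ e ∷ []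

F : List Digit → List Digit
F = concatMap f

G : List Digit → List Letter
G = concatMap g

Fpow : ℕ → List Digit → List Digit
Fpow zero    u = u
Fpow (suc k) u = F (Fpow k u)

Seq : Set → Set
Seq A = ℕ → A

nth : {A : Set} → A → List A → ℕ → A
nth x₀ []       _       = x₀
nth x₀ (x ∷ xs) zero    = x
nth x₀ (x ∷ xs) (suc n) = nth x₀ xs n

-- Since f(0) begins with 0, each g(f^k(0)) is a prefix of
-- g(f^{k+1}(0)), and |g(f^{n+1}(0))| ≥ 8·5^(n+1) > n, so the n-th letter of
-- w₅ is the n-th letter of g(f^{n+1}(0)) (the default is never used).
w5 : Seq Letter
w5 n = nth a (G (Fpow (suc n) (⁰ ∷ []))) n

slice : {A : Set} → Seq A → ℕ → ℕ → List A
slice w i zero    = []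
slice w i (suc n) = w i ∷ slice w (suc i) n

IsFactor : {A : Set} → List A → Seq A → Set
IsFactor u w = ∃ λ i → slice w i (length u) ≡ u

IsConjugate : {A : Set} → List A → List A → Set
IsConjugate v u = Σ _ λ x → Σ _ λ y → (u ≡ x ++ y) × (v ≡ y ++ x)

w24 : List Digit
w24 = ² ∷ ⁴ ∷ []

w01240 : List Digit
w01240 = ⁰ ∷ ¹ ∷ ² ∷ ⁴ ∷ ⁰ ∷ []

prodP : ℕ → List Digit
prodP zero    = w24
prodP (suc n) = prodP n ++ Fpow (suc n) w24

prodS : ℕ → List Digit
prodS zero    = []
prodS (suc n) = Fpow n w01240 ++ prodS n

p0324 : ℕ → List Letter
p0324 n = (a ∷ c ∷ d ∷ b ∷ e ∷ c ∷ d ∷ []) ++ G (prodP n)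

s0324 : ℕ → List Letter
s0324 n = G (prodS n) ++ (a ∷ b ∷ c ∷ d ∷ b ∷ e ∷ c ∷ d ∷ e ∷ [])

T0324 : ℕ → List Letter
T0324 n = p0324 n ++ G (Fpow n (⁰ ∷ [])) ++ s0324 n

w0324 : List Digit
w0324 = ⁰ ∷ ³ ∷ ² ∷ ⁴ ∷ []

-- T is a conjugate of g(f^d(0324)) because g(3) = abcdbecde·acdbecd and
-- f^d(324) = f^{d-1}(01240)⋯01240 · 3 · 24 f(24)⋯f^d(24), both by f(3) = 01240·324.
--
-- For the non-factor part, f and g are recognisable: every image begins with the marker
-- 012 (resp. abcd), and the marker occurs in an image followed by a marker only at the
-- two boundaries. Write Q_d = 24 f(24)⋯f^d(24) · f^d(0) · f^{d-1}(01240)⋯01240, so that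
-- T = acdbecd · g(Q_d) · abcdbecde. Cutting an occurrence of T in g(f^M(0)) at markers
-- shows that f^M(0) contains 3·Q_d·c with c ∈ {3,4}. Since Q_{d+1} = 24·f(Q_d)·01240, the
-- same argument for f turns 3·Q_{d+1}·c in f^{k+1}(0) into 3·Q_d·c' in f^k(0), and at
-- d = 0 the word 3240c does not occur in any f(y) at all.

module Submission where

open import Defs
open import Data.Nat using (ℕ)
open import Data.Product using (_×_)
open import Relation.Nullary using (¬_)

open import Data.Nat as ℕ using (zero; suc; _+_; _≤_; _<_; _≤′_; ≤′-refl; ≤′-step; s≤s; z≤n)
open import Data.Nat.Properties
  using (≤-total; ≤-trans; ≤-<-trans; <⇒≤; m≤n+m; m<m+n; n≤1+n; +-suc; ≤⇒≤′)
open import Data.Fin as Fin using (Fin; toℕ)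
import Data.Fin.Properties as Fin
open import Data.List using (List; []; _∷_; [_]; _++_; concatMap; length; take; drop)
open import Data.List.Properties
  using (++-assoc; ++-identityʳ; ++-identityʳ-unique; ++-conicalˡ; ++-conicalʳ; ++-cancelˡ;
         ∷-injective; concatMap-++; length-++; take++drop≡id; ≡-dec)
open import Data.List.Relation.Binary.Prefix.Heterogeneous using (Prefix; []; _∷_)
open import Data.List.Relation.Binary.Prefix.Heterogeneous.Properties using (prefix?)
open import Data.Product using (∃; ∃₂; _,_; proj₁; proj₂)
open import Data.Sum as Sum using (_⊎_; inj₁; inj₂)
open import Data.Empty using (⊥-elim)
open import Function using (_∘_)
open import Function.Bundles using (mk↣)
open import Relation.Binary.Definitions using (Decidable; DecidableEquality)
open import Relation.Nullary.Decidable
  using (Dec; map′; via-injection; from-yes; ¬?; _×-dec_; _⊎-dec_; _→-dec_)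
open import Relation.Binary.PropositionalEquality hiding ([_])
open ≡-Reasoning

module _ {A : Set} where

  split-++≡++ : ∀ (p r α s : List A) → p ++ r ≡ α ++ s →
    (∃ λ α′ → α ≡ p ++ α′ × r ≡ α′ ++ s) ⊎
    (∃ λ (k : Fin (length p)) → α ≡ take (toℕ k) p × s ≡ drop (toℕ k) p ++ r)
  split-++≡++ [] r α s eq = inj₁ (α , refl , eq)
  split-++≡++ (x ∷ p) r [] s eq = inj₂ (Fin.zero , refl , sym eq)
  split-++≡++ (x ∷ p) r (y ∷ α) s eq with ∷-injective eq
  ... | refl , eq′ = Sum.map (λ (α′ , α≡ , r≡) → α′ , cong (x ∷_) α≡ , r≡)
                             (λ (k , α≡ , s≡) → Fin.suc k , cong (x ∷_) α≡ , s≡)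
                             (split-++≡++ p r α s eq′)

  Comparable : List A → List A → Set
  Comparable u v = Prefix _≡_ u v ⊎ Prefix _≡_ v u

  ++-comparable : ∀ u v {γ δ} → u ++ γ ≡ v ++ δ → Comparable u v
  ++-comparable [] v _ = inj₁ []
  ++-comparable (x ∷ u) [] _ = inj₂ []
  ++-comparable (x ∷ u) (y ∷ v) eq with ∷-injective eq
  ... | refl , eq′ = Sum.map (refl ∷_) (refl ∷_) (++-comparable u v eq′)

  comparable? : DecidableEquality A → Decidable Comparable
  comparable? _≟_ u v = prefix? _≟_ u v ⊎-dec prefix? _≟_ v u

  nth-++ : ∀ (x₀ : A) p q {j} → j < length p → nth x₀ (p ++ q) j ≡ nth x₀ p j
  nth-++ x₀ (x ∷ p) q {zero} _ = refl
  nth-++ x₀ (x ∷ p) q {suc j} (s≤s j<p) = nth-++ x₀ p q j<p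

  drop-nth : ∀ (x₀ : A) W {i} → i < length W → drop i W ≡ nth x₀ W i ∷ drop (suc i) W
  drop-nth x₀ (x ∷ W) {zero} _ = refl
  drop-nth x₀ (x ∷ W) {suc i} (s≤s i<W) = drop-nth x₀ W i<W

  slice-≡-take-drop : ∀ (x₀ : A) (w : Seq A) W → (∀ j → j < length W → w j ≡ nth x₀ W j) →
    ∀ L i → L + i ≤ length W → slice w i L ≡ take L (drop i W)
  slice-≡-take-drop x₀ w W agree zero i _ = refl
  slice-≡-take-drop x₀ w W agree (suc L) i 1+L+i≤W = begin
    w i ∷ slice w (suc i) L                     ≡⟨ cong₂ _∷_ (agree i i<W) rest ⟩
    nth x₀ W i ∷ take L (drop (suc i) W)        ≡⟨ cong (take (suc L)) (drop-nth x₀ W i<W) ⟨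
    take (suc L) (drop i W)                     ∎
    where
    i<W : i < length W
    i<W = ≤-trans (s≤s (m≤n+m i L)) 1+L+i≤W
    rest : slice w (suc i) L ≡ take L (drop (suc i) W)
    rest = slice-≡-take-drop x₀ w W agree L (suc i) (subst (_≤ length W) (sym (+-suc L i)) 1+L+i≤W)

module Enumerated {A : Set} {n : ℕ} (enum : Fin n → A) (index : A → Fin n)
                  (enum-index : ∀ x → enum (index x) ≡ x) where

  index-injective : ∀ {x y} → index x ≡ index y → x ≡ y
  index-injective {x} {y} eq = trans (sym (enum-index x)) (trans (cong enum eq) (enum-index y))

  _≟_ : DecidableEquality A
  _≟_ = via-injection (mk↣ index-injective) Fin._≟_

  all? : {P : A → Set} → (∀ x → Dec (P x)) → Dec (∀ x → P x)
  all? {P} P? = map′ (λ p x → subst P (enum-index x) (p (index x))) (λ p i → p (enum i))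
                     (Fin.all? (P? ∘ enum))

module Recognisable {A B : Set} (h : A → List B) (m : List B) (m≢[] : m ≢ [])
                    (starts : ∀ x → ∃ λ t → h x ≡ m ++ t) where

  H : List A → List B
  H = concatMap h

  H-++ : ∀ u v → H (u ++ v) ≡ H u ++ H v
  H-++ = concatMap-++ h

  H-≡[] : ∀ {y} → H y ≡ [] → y ≡ []
  H-≡[] {[]} _ = refl
  H-≡[] {x ∷ y} Hy≡[] with starts x
  ... | t , hx≡ = ⊥-elim (m≢[] (++-conicalˡ m t (trans (sym hx≡) (++-conicalˡ (h x) (H y) Hy≡[]))))

  -- "r is empty or begins with m", weakened to the form the comparisons below actually use.
  Marked : List B → Set
  Marked r = ∃ λ γ → r ++ m ≡ m ++ γ

  ++-marked : ∀ {r s} → Marked r → Marked s → Marked (r ++ s)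
  ++-marked {r} {s} (γ , r++m≡) (δ , s++m≡) = γ ++ δ , (begin
    (r ++ s) ++ m    ≡⟨ ++-assoc r s m ⟩
    r ++ s ++ m      ≡⟨ cong (r ++_) s++m≡ ⟩
    r ++ m ++ δ      ≡⟨ ++-assoc r m δ ⟨
    (r ++ m) ++ δ    ≡⟨ cong (_++ δ) r++m≡ ⟩
    (m ++ γ) ++ δ    ≡⟨ ++-assoc m γ δ ⟩
    m ++ γ ++ δ      ∎)

  H-marked : ∀ y → Marked (H y)
  H-marked [] = [] , sym (++-identityʳ m)
  H-marked (x ∷ y) with starts x
  ... | t , hx≡ = ++-marked (t ++ m , trans (cong (_++ m) hx≡) (++-assoc m t m)) (H-marked y)

  marked-++-marker : ∀ {r} → Marked r → ∀ γ → ∃ λ δ → r ++ m ++ γ ≡ m ++ δ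
  marked-++-marker {r} (δ , r++m≡) γ = δ ++ γ , (begin
    r ++ m ++ γ      ≡⟨ ++-assoc r m γ ⟨
    (r ++ m) ++ γ    ≡⟨ cong (_++ γ) r++m≡ ⟩
    (m ++ δ) ++ γ    ≡⟨ ++-assoc m δ γ ⟩
    m ++ δ ++ γ      ∎)

  -- A word read where v is followed by a marked word agrees with v ++ m as far as both go;
  -- with v = drop k (h x) this reduces statements about all H y to finite checks on images.
  marked-comparable : ∀ {u γ v r} → Marked r → u ++ γ ≡ v ++ r → Comparable u (v ++ m)
  marked-comparable {u} {γ} {v} {r} (δ , r++m≡) eq = ++-comparable u (v ++ m) (begin
    u ++ γ ++ m      ≡⟨ ++-assoc u γ m ⟨
    (u ++ γ) ++ m    ≡⟨ cong (_++ m) eq ⟩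
    (v ++ r) ++ m    ≡⟨ ++-assoc v r m ⟩
    v ++ r ++ m      ≡⟨ cong (v ++_) r++m≡ ⟩
    v ++ m ++ δ      ≡⟨ ++-assoc v m δ ⟨
    (v ++ m) ++ δ    ∎)

  record Split (y : List A) (α s : List B) : Set where
    field
      before : List A
      letter : A
      after  : List A
      offset : Fin (length (h letter))
      y≡ : y ≡ before ++ letter ∷ after
      α≡ : α ≡ H before ++ take (toℕ offset) (h letter)
      s≡ : s ≡ drop (toℕ offset) (h letter) ++ H after

  locate : ∀ y α s → s ≢ [] → H y ≡ α ++ s → Split y α s
  locate [] α s s≢[] eq = ⊥-elim (s≢[] (++-conicalʳ α s (sym eq)))
  locate (x ∷ y) α s s≢[] eq with split-++≡++ (h x) (H y) α s eq
  ... | inj₂ (k , α≡ , s≡) = record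
    { before = [] ; letter = x ; after = y ; offset = k ; y≡ = refl ; α≡ = α≡ ; s≡ = s≡ }
  ... | inj₁ (α′ , refl , eq′) = record
    { before = x ∷ before ; letter = letter ; after = after ; offset = offset
    ; y≡ = cong (x ∷_) y≡
    ; α≡ = trans (cong (h x ++_) α≡) (sym (++-assoc (h x) (H before) _))
    ; s≡ = s≡ }
    where open Split (locate y α′ s s≢[] eq′)

  Avoids : List B → Set
  Avoids P = ∀ x (k : Fin (length (h x))) → ¬ Comparable P (drop (toℕ k) (h x) ++ m)

  avoids⇒∉ : ∀ {P} → Avoids P → P ≢ [] → ∀ y α β → H y ≢ α ++ P ++ β
  avoids⇒∉ {P} avoids P≢[] y α β eq = avoids letter offset (marked-comparable (H-marked after) s≡)
    where open Split (locate y α (P ++ β) (P≢[] ∘ ++-conicalˡ P β) eq)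

  Synchronizing : Set
  Synchronizing = ∀ x (k : Fin (length (h x))) → Comparable m (drop (toℕ k) (h x) ++ m) → toℕ k ≡ 0

  split-at-marker : Synchronizing → ∀ y α s → (∃ λ γ → s ≡ m ++ γ) → H y ≡ α ++ s →
    ∃₂ λ y₁ y₂ → y ≡ y₁ ++ y₂ × H y₁ ≡ α × H y₂ ≡ s
  split-at-marker sync y α s (γ , refl) eq =
    before , letter ∷ after , y≡ ,
    trans (sym (++-identityʳ (H before))) (sym (subst (λ k → α ≡ H before ++ take k (h letter)) offset≡0 α≡)) ,
    sym (subst (λ k → s ≡ drop k (h letter) ++ H after) offset≡0 s≡)
    where
    open Split (locate y α s (m≢[] ∘ ++-conicalˡ m γ) eq)
    offset≡0 : toℕ offset ≡ 0
    offset≡0 = sync letter offset (marked-comparable (H-marked after) s≡)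

  Separating : Set
  Separating = ∀ x q → Comparable (h x ++ m) (h q ++ m) → x ≡ q

  separate : Separating → ∀ {x q u v} → Marked u → Marked v → h x ++ u ≡ h q ++ v → x ≡ q
  separate sep {x} {q} {u} {v} (γ , u++m≡) v-marked eq =
    sep x q (marked-comparable (++-marked v-marked (m , refl)) (begin
      (h x ++ m) ++ γ    ≡⟨ ++-assoc (h x) m γ ⟩
      h x ++ m ++ γ      ≡⟨ cong (h x ++_) u++m≡ ⟨
      h x ++ u ++ m      ≡⟨ ++-assoc (h x) u m ⟨
      (h x ++ u) ++ m    ≡⟨ cong (_++ m) eq ⟩
      (h q ++ v) ++ m    ≡⟨ ++-assoc (h q) v m ⟩
      h q ++ v ++ m      ∎))

  cancelˡ : Separating → ∀ Q y {s} → Marked s → H y ≡ H Q ++ s → ∃ λ y′ → y ≡ Q ++ y′ × H y′ ≡ s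
  cancelˡ sep [] y _ eq = y , refl , eq
  cancelˡ sep (q ∷ Q) [] {s} _ eq with H-≡[] {q ∷ Q} (++-conicalˡ (H (q ∷ Q)) s (sym eq))
  ... | ()
  cancelˡ sep (q ∷ Q) (x ∷ y) {s} s-marked eq
    with separate sep (H-marked y) (++-marked (H-marked Q) s-marked) (trans eq (++-assoc (h q) (H Q) s))
  ... | refl with cancelˡ sep Q y s-marked (++-cancelˡ (h x) (H y) (H Q ++ s) (trans eq (++-assoc (h x) (H Q) s)))
  ... | y′ , refl , Hy′≡s = y′ , refl , Hy′≡s

  ForcesLast : List B → A → Set
  ForcesLast L ℓ = ∀ x (k : Fin (length (h x))) →
    Comparable L (drop (toℕ k) (h x) ++ m) → x ≡ ℓ × drop (toℕ k) (h x) ≡ L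

  forcesLast⇒ : ∀ {L ℓ} → ForcesLast L ℓ → L ≢ [] → ∀ y α → H y ≡ α ++ L → ∃ λ z → y ≡ z ++ [ ℓ ]
  forcesLast⇒ {L} {ℓ} forces L≢[] y α eq = before , (begin
    y                        ≡⟨ y≡ ⟩
    before ++ letter ∷ after ≡⟨ cong₂ (λ x z → before ++ x ∷ z) (proj₁ pinned) after≡[] ⟩
    before ++ [ ℓ ]          ∎)
    where
    open Split (locate y α L L≢[] eq)
    pinned : letter ≡ ℓ × drop (toℕ offset) (h letter) ≡ L
    pinned = forces letter offset (marked-comparable (H-marked after) (trans (++-identityʳ L) s≡))
    after≡[] : after ≡ []
    after≡[] = H-≡[] (++-identityʳ-unique L (trans s≡ (cong (_++ H after) (proj₂ pinned))))

  ForcesFirst : List B → (A → Set) → Set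
  ForcesFirst R P = ∀ x → Comparable (m ++ R) (h x ++ m) → P x

  desubstitute : Synchronizing → Separating → ∀ {L ℓ R P} → ForcesLast L ℓ → L ≢ [] → ForcesFirst R P →
    ∀ y α Q β → H y ≡ α ++ L ++ H Q ++ m ++ R ++ β →
    ∃ λ α′ → ∃ λ x → ∃ λ β′ → P x × y ≡ α′ ++ ℓ ∷ Q ++ x ∷ β′
  desubstitute sync sep {L} {ℓ} {R} {P} last L≢[] first y α Q β eq
    with split-at-marker sync y (α ++ L) (H Q ++ m ++ R ++ β) (marked-++-marker (H-marked Q) (R ++ β))
                         (trans eq (sym (++-assoc α L _)))
  ... | y₁ , y₂ , refl , Hy₁ , Hy₂
    with forcesLast⇒ last L≢[] y₁ α Hy₁ | cancelˡ sep Q y₂ ((R ++ β) ++ m , ++-assoc m (R ++ β) m) Hy₂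
  ... | _ , refl | [] , _ , Hy₃ = ⊥-elim (m≢[] (++-conicalˡ m (R ++ β) (sym Hy₃)))
  ... | z , refl | x ∷ y₄ , refl , Hy₃ =
    z , x , y₄ , first x (marked-comparable (H-marked y₄) (trans (++-assoc m R β) (sym Hy₃))) ,
    ++-assoc z [ ℓ ] (Q ++ x ∷ y₄)

  module Decide (all? : ∀ {P : A → Set} → (∀ x → Dec (P x)) → Dec (∀ x → P x))
                (_≟ᴬ_ : DecidableEquality A) (_≟ᴮ_ : DecidableEquality B) where

    synchronizing? : Dec Synchronizing
    synchronizing? = all? λ x → Fin.all? λ k → comparable? _≟ᴮ_ m _ →-dec toℕ k ℕ.≟ 0

    separating? : Dec Separating
    separating? = all? λ x → all? λ q → comparable? _≟ᴮ_ (h x ++ m) (h q ++ m) →-dec x ≟ᴬ q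

    avoids? : ∀ P → Dec (Avoids P)
    avoids? P = all? λ x → Fin.all? λ k → ¬? (comparable? _≟ᴮ_ P _)

    forcesLast? : ∀ L ℓ → Dec (ForcesLast L ℓ)
    forcesLast? L ℓ = all? λ x → Fin.all? λ k →
      comparable? _≟ᴮ_ L _ →-dec (x ≟ᴬ ℓ ×-dec ≡-dec _≟ᴮ_ _ L)

    forcesFirst? : ∀ R {P} → (∀ x → Dec (P x)) → Dec (ForcesFirst R P)
    forcesFirst? R P? = all? λ x → comparable? _≟ᴮ_ (m ++ R) (h x ++ m) →-dec P? x

digitAt : Fin 5 → Digit
digitAt Fin.zero = ⁰
digitAt (Fin.suc Fin.zero) = ¹
digitAt (Fin.suc (Fin.suc Fin.zero)) = ²
digitAt (Fin.suc (Fin.suc (Fin.suc Fin.zero))) = ³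
digitAt (Fin.suc (Fin.suc (Fin.suc (Fin.suc Fin.zero)))) = ⁴

digitIndex : Digit → Fin 5
digitIndex ⁰ = Fin.zero
digitIndex ¹ = Fin.suc Fin.zero
digitIndex ² = Fin.suc (Fin.suc Fin.zero)
digitIndex ³ = Fin.suc (Fin.suc (Fin.suc Fin.zero))
digitIndex ⁴ = Fin.suc (Fin.suc (Fin.suc (Fin.suc Fin.zero)))

digitAt-digitIndex : ∀ x → digitAt (digitIndex x) ≡ x
digitAt-digitIndex ⁰ = refl
digitAt-digitIndex ¹ = refl
digitAt-digitIndex ² = refl
digitAt-digitIndex ³ = refl
digitAt-digitIndex ⁴ = refl

letterAt : Fin 5 → Letter
letterAt Fin.zero = a
letterAt (Fin.suc Fin.zero) = b
letterAt (Fin.suc (Fin.suc Fin.zero)) = c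
letterAt (Fin.suc (Fin.suc (Fin.suc Fin.zero))) = d
letterAt (Fin.suc (Fin.suc (Fin.suc (Fin.suc Fin.zero)))) = e

letterIndex : Letter → Fin 5
letterIndex a = Fin.zero
letterIndex b = Fin.suc Fin.zero
letterIndex c = Fin.suc (Fin.suc Fin.zero)
letterIndex d = Fin.suc (Fin.suc (Fin.suc Fin.zero))
letterIndex e = Fin.suc (Fin.suc (Fin.suc (Fin.suc Fin.zero)))

letterAt-letterIndex : ∀ x → letterAt (letterIndex x) ≡ x
letterAt-letterIndex a = refl
letterAt-letterIndex b = refl
letterAt-letterIndex c = refl
letterAt-letterIndex d = refl
letterAt-letterIndex e = refl

module Digits = Enumerated digitAt digitIndex digitAt-digitIndex
module Letters = Enumerated letterAt letterIndex letterAt-letterIndex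

ThreeOrFour : Digit → Set
ThreeOrFour x = x ≡ ³ ⊎ x ≡ ⁴

threeOrFour? : ∀ x → Dec (ThreeOrFour x)
threeOrFour? x = x Digits.≟ ³ ⊎-dec x Digits.≟ ⁴

f-starts : ∀ x → ∃ λ t → f x ≡ (⁰ ∷ ¹ ∷ ² ∷ []) ++ t
f-starts ⁰ = _ , refl
f-starts ¹ = _ , refl
f-starts ² = _ , refl
f-starts ³ = _ , refl
f-starts ⁴ = _ , refl

g-starts : ∀ x → ∃ λ t → g x ≡ (a ∷ b ∷ c ∷ d ∷ []) ++ t
g-starts ⁰ = _ , refl
g-starts ¹ = _ , refl
g-starts ² = _ , refl
g-starts ³ = _ , refl
g-starts ⁴ = _ , refl

module Fᴿ = Recognisable f (⁰ ∷ ¹ ∷ ² ∷ []) (λ ()) f-starts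
module Gᴿ = Recognisable g (a ∷ b ∷ c ∷ d ∷ []) (λ ()) g-starts
module Fᴰ = Fᴿ.Decide Digits.all? Digits._≟_ Digits._≟_
module Gᴰ = Gᴿ.Decide Digits.all? Digits._≟_ Letters._≟_

f-synchronizing : Fᴿ.Synchronizing
f-synchronizing = from-yes Fᴰ.synchronizing?

f-separating : Fᴿ.Separating
f-separating = from-yes Fᴰ.separating?

f-forcesLast : Fᴿ.ForcesLast (³ ∷ ² ∷ ⁴ ∷ []) ³
f-forcesLast = from-yes (Fᴰ.forcesLast? (³ ∷ ² ∷ ⁴ ∷ []) ³)

f-forcesFirst : ∀ {c} → ThreeOrFour c → Fᴿ.ForcesFirst (⁴ ∷ ⁰ ∷ c ∷ []) ThreeOrFour
f-forcesFirst (inj₁ refl) = from-yes (Fᴰ.forcesFirst? (⁴ ∷ ⁰ ∷ ³ ∷ []) threeOrFour?)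
f-forcesFirst (inj₂ refl) = from-yes (Fᴰ.forcesFirst? (⁴ ∷ ⁰ ∷ ⁴ ∷ []) threeOrFour?)

f-avoids : ∀ {c} → ThreeOrFour c → Fᴿ.Avoids (³ ∷ ² ∷ ⁴ ∷ ⁰ ∷ c ∷ [])
f-avoids (inj₁ refl) = from-yes (Fᴰ.avoids? (³ ∷ ² ∷ ⁴ ∷ ⁰ ∷ ³ ∷ []))
f-avoids (inj₂ refl) = from-yes (Fᴰ.avoids? (³ ∷ ² ∷ ⁴ ∷ ⁰ ∷ ⁴ ∷ []))

g-synchronizing : Gᴿ.Synchronizing
g-synchronizing = from-yes Gᴰ.synchronizing?

g-separating : Gᴿ.Separating
g-separating = from-yes Gᴰ.separating?

g-forcesLast : Gᴿ.ForcesLast (a ∷ c ∷ d ∷ b ∷ e ∷ c ∷ d ∷ []) ³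
g-forcesLast = from-yes (Gᴰ.forcesLast? (a ∷ c ∷ d ∷ b ∷ e ∷ c ∷ d ∷ []) ³)

g-forcesFirst : Gᴿ.ForcesFirst (b ∷ e ∷ c ∷ d ∷ e ∷ []) ThreeOrFour
g-forcesFirst = from-yes (Gᴰ.forcesFirst? (b ∷ e ∷ c ∷ d ∷ e ∷ []) threeOrFour?)

Fpow-++ : ∀ n u v → Fpow n (u ++ v) ≡ Fpow n u ++ Fpow n v
Fpow-++ zero u v = refl
Fpow-++ (suc n) u v = trans (cong F (Fpow-++ n u v)) (Fᴿ.H-++ (Fpow n u) (Fpow n v))

prodP-suc : ∀ n → prodP (suc n) ≡ w24 ++ F (prodP n)
prodP-suc zero = refl
prodP-suc (suc n) = begin
  prodP (suc n) ++ F (Fpow (suc n) w24)         ≡⟨ cong (_++ F (Fpow (suc n) w24)) (prodP-suc n) ⟩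
  w24 ++ F (prodP n) ++ F (Fpow (suc n) w24)    ≡⟨ cong (w24 ++_) (Fᴿ.H-++ (prodP n) _) ⟨
  w24 ++ F (prodP (suc n))                      ∎

prodS-suc : ∀ n → prodS (suc n) ≡ F (prodS n) ++ w01240
prodS-suc zero = refl
prodS-suc (suc n) = begin
  F (Fpow n w01240) ++ prodS (suc n)              ≡⟨ cong (F (Fpow n w01240) ++_) (prodS-suc n) ⟩
  F (Fpow n w01240) ++ F (prodS n) ++ w01240      ≡⟨ ++-assoc (F (Fpow n w01240)) _ _ ⟨
  (F (Fpow n w01240) ++ F (prodS n)) ++ w01240    ≡⟨ cong (_++ w01240) (Fᴿ.H-++ (Fpow n w01240) _) ⟨
  F (prodS (suc n)) ++ w01240                     ∎

Fpow-324 : ∀ n → Fpow n (³ ∷ ² ∷ ⁴ ∷ []) ≡ prodS n ++ ³ ∷ prodP n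
Fpow-324 zero = refl
Fpow-324 (suc n) = begin
  F (Fpow n (³ ∷ ² ∷ ⁴ ∷ []))                    ≡⟨ cong F (Fpow-324 n) ⟩
  F (prodS n ++ ³ ∷ prodP n)                      ≡⟨ Fᴿ.H-++ (prodS n) (³ ∷ prodP n) ⟩
  F (prodS n) ++ w01240 ++ ³ ∷ w24 ++ F (prodP n) ≡⟨ ++-assoc (F (prodS n)) w01240 _ ⟨
  (F (prodS n) ++ w01240) ++ ³ ∷ w24 ++ F (prodP n)
    ≡⟨ cong₂ (λ u v → u ++ ³ ∷ v) (prodS-suc n) (prodP-suc n) ⟨
  prodS (suc n) ++ ³ ∷ prodP (suc n)              ∎

g³-prefix g³-suffix : List Letter
g³-prefix = a ∷ b ∷ c ∷ d ∷ b ∷ e ∷ c ∷ d ∷ e ∷ []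
g³-suffix = a ∷ c ∷ d ∷ b ∷ e ∷ c ∷ d ∷ []

G-Fpow-0324 : ∀ n → G (Fpow n w0324) ≡ (G (Fpow n [ ⁰ ]) ++ s0324 n) ++ p0324 n
G-Fpow-0324 n = begin
  G (Fpow n ([ ⁰ ] ++ ³ ∷ ² ∷ ⁴ ∷ []))    ≡⟨ cong G (Fpow-++ n [ ⁰ ] _) ⟩
  G (Z ++ Fpow n (³ ∷ ² ∷ ⁴ ∷ []))         ≡⟨ cong (λ u → G (Z ++ u)) (Fpow-324 n) ⟩
  G (Z ++ prodS n ++ ³ ∷ prodP n)          ≡⟨ Gᴿ.H-++ Z _ ⟩
  G Z ++ G (prodS n ++ ³ ∷ prodP n)        ≡⟨ cong (G Z ++_) (Gᴿ.H-++ (prodS n) _) ⟩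
  G Z ++ GS ++ g³-prefix ++ g³-suffix ++ GP  ≡⟨ cong (G Z ++_) (++-assoc GS g³-prefix _) ⟨
  G Z ++ s0324 n ++ p0324 n                ≡⟨ ++-assoc (G Z) _ _ ⟨
  (G Z ++ s0324 n) ++ p0324 n              ∎
  where
  Z : List Digit
  Z = Fpow n [ ⁰ ]
  GS GP : List Letter
  GS = G (prodS n)
  GP = G (prodP n)

T0324-conjugate : ∀ n → IsConjugate (T0324 n) (G (Fpow n w0324))
T0324-conjugate n = G (Fpow n [ ⁰ ]) ++ s0324 n , p0324 n , G-Fpow-0324 n , refl

core : ℕ → List Digit
core n = prodP n ++ Fpow n [ ⁰ ] ++ prodS n

core-suc : ∀ n → core (suc n) ≡ ² ∷ ⁴ ∷ F (core n) ++ w01240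
core-suc n = begin
  prodP (suc n) ++ FZ ++ prodS (suc n)      ≡⟨ cong₂ (λ u v → u ++ FZ ++ v) (prodP-suc n) (prodS-suc n) ⟩
  ² ∷ ⁴ ∷ FP ++ FZ ++ FS ++ w01240          ≡⟨ cong (λ u → ² ∷ ⁴ ∷ FP ++ u) (++-assoc FZ FS w01240) ⟨
  ² ∷ ⁴ ∷ FP ++ (FZ ++ FS) ++ w01240        ≡⟨ cong (λ u → ² ∷ ⁴ ∷ u) (++-assoc FP _ w01240) ⟨
  ² ∷ ⁴ ∷ (FP ++ FZ ++ FS) ++ w01240        ≡⟨ cong (λ u → ² ∷ ⁴ ∷ (FP ++ u) ++ w01240) (Fᴿ.H-++ Z S) ⟨
  ² ∷ ⁴ ∷ (FP ++ F (Z ++ S)) ++ w01240      ≡⟨ cong (λ u → ² ∷ ⁴ ∷ u ++ w01240) (Fᴿ.H-++ P (Z ++ S)) ⟨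
  ² ∷ ⁴ ∷ F (core n) ++ w01240              ∎
  where
  P Z S FP FZ FS : List Digit
  P = prodP n
  Z = Fpow n [ ⁰ ]
  S = prodS n
  FP = F P
  FZ = F Z
  FS = F S

T0324-core : ∀ n → T0324 n ≡ g³-suffix ++ G (core n) ++ g³-prefix
T0324-core n = cong (g³-suffix ++_) (begin
  GP ++ GZ ++ GS ++ g³-prefix       ≡⟨ cong (GP ++_) (++-assoc GZ GS g³-prefix) ⟨
  GP ++ (GZ ++ GS) ++ g³-prefix     ≡⟨ ++-assoc GP _ g³-prefix ⟨
  (GP ++ GZ ++ GS) ++ g³-prefix     ≡⟨ cong (λ u → (GP ++ u) ++ g³-prefix) (Gᴿ.H-++ Z S) ⟨
  (GP ++ G (Z ++ S)) ++ g³-prefix   ≡⟨ cong (_++ g³-prefix) (Gᴿ.H-++ P (Z ++ S)) ⟨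
  G (core n) ++ g³-prefix           ∎)
  where
  P Z S : List Digit
  P = prodP n
  Z = Fpow n [ ⁰ ]
  S = prodS n
  GP GZ GS : List Letter
  GP = G P
  GZ = G Z
  GS = G S

core-not-bracketed : ∀ n k α x β → ThreeOrFour x → Fpow k [ ⁰ ] ≢ α ++ ³ ∷ core n ++ x ∷ β
core-not-bracketed n zero [] x β _ ()
core-not-bracketed n zero (_ ∷ []) x β _ ()
core-not-bracketed n zero (_ ∷ _ ∷ _) x β _ ()
core-not-bracketed zero (suc k) α x β x∈34 eq =
  Fᴿ.avoids⇒∉ (f-avoids x∈34) (λ ()) (Fpow k [ ⁰ ]) α β eq
core-not-bracketed (suc n) (suc k) α x β x∈34 eq
  with Fᴿ.desubstitute f-synchronizing f-separating f-forcesLast (λ ()) (f-forcesFirst x∈34)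
         (Fpow k [ ⁰ ]) α (core n) β
         (trans eq (cong (λ u → α ++ ³ ∷ u)
           (trans (cong (_++ x ∷ β) (core-suc n)) (cong (λ u → ² ∷ ⁴ ∷ u) (++-assoc (F (core n)) w01240 (x ∷ β))))))
... | α′ , x′ , β′ , x′∈34 , eq′ = core-not-bracketed n k α′ x′ β′ x′∈34 eq′

Fpow-⁰-grows : ∀ k → ∃₂ λ x t → Fpow (suc k) [ ⁰ ] ≡ Fpow k [ ⁰ ] ++ x ∷ t
Fpow-⁰-grows zero = ¹ , _ , refl
Fpow-⁰-grows (suc k) with Fpow-⁰-grows k
... | x , t , eq with f-starts x
... | t′ , fx≡ = ⁰ , ¹ ∷ ² ∷ t′ ++ F t , (begin
  F (Fpow (suc k) [ ⁰ ])                    ≡⟨ cong F eq ⟩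
  F (Fpow k [ ⁰ ] ++ x ∷ t)                 ≡⟨ Fᴿ.H-++ (Fpow k [ ⁰ ]) (x ∷ t) ⟩
  Fpow (suc k) [ ⁰ ] ++ f x ++ F t          ≡⟨ cong (λ u → Fpow (suc k) [ ⁰ ] ++ u ++ F t) fx≡ ⟩
  Fpow (suc k) [ ⁰ ] ++ ⁰ ∷ ¹ ∷ ² ∷ t′ ++ F t ∎)

Fpow-⁰-prefix : ∀ {j k} → j ≤′ k → ∃ λ t → Fpow k [ ⁰ ] ≡ Fpow j [ ⁰ ] ++ t
Fpow-⁰-prefix {j} ≤′-refl = [] , sym (++-identityʳ (Fpow j [ ⁰ ]))
Fpow-⁰-prefix {j} (≤′-step {k} j≤′k) with Fpow-⁰-prefix j≤′k | Fpow-⁰-grows k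
... | t , eq | x , t′ , eq′ =
  t ++ x ∷ t′ , trans eq′ (trans (cong (_++ x ∷ t′) eq) (++-assoc (Fpow j [ ⁰ ]) t (x ∷ t′)))

length-Fpow-⁰ : ∀ k → k < length (Fpow k [ ⁰ ])
length-Fpow-⁰ zero = s≤s z≤n
length-Fpow-⁰ (suc k) with Fpow-⁰-grows k
... | x , t , eq rewrite eq | length-++ (Fpow k [ ⁰ ]) {x ∷ t} =
  ≤-<-trans (length-Fpow-⁰ k) (m<m+n (length (Fpow k [ ⁰ ])) (s≤s z≤n))

length-≤-G : ∀ u → length u ≤ length (G u)
length-≤-G [] = z≤n
length-≤-G (x ∷ u) with g-starts x
... | t , gx≡ rewrite gx≡ | length-++ t {G u} =
  s≤s (≤-trans (length-≤-G u) (m≤n+m (length (G u)) (suc (suc (suc (length t))))))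

length-G-Fpow-⁰ : ∀ k → k < length (G (Fpow k [ ⁰ ]))
length-G-Fpow-⁰ k = ≤-trans (length-Fpow-⁰ k) (length-≤-G (Fpow k [ ⁰ ]))

nth-G-++ : ∀ u t {j} → j < length (G u) → nth a (G (u ++ t)) j ≡ nth a (G u) j
nth-G-++ u t {j} j<Gu = trans (cong (λ w → nth a w j) (Gᴿ.H-++ u t)) (nth-++ a (G u) (G t) j<Gu)

w5-nth : ∀ M j → j < length (G (Fpow M [ ⁰ ])) → w5 j ≡ nth a (G (Fpow M [ ⁰ ])) j
w5-nth M j j<GM with ≤-total (suc j) M
... | inj₁ 1+j≤M with Fpow-⁰-prefix (≤⇒≤′ 1+j≤M)
...   | t , eq = trans (sym (nth-G-++ (Fpow (suc j) [ ⁰ ]) t j<G1+j)) (cong (λ u → nth a (G u) j) (sym eq))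
  where
  j<G1+j : j < length (G (Fpow (suc j) [ ⁰ ]))
  j<G1+j = ≤-trans (n≤1+n (suc j)) (length-G-Fpow-⁰ (suc j))
w5-nth M j j<GM | inj₂ M≤1+j with Fpow-⁰-prefix (≤⇒≤′ M≤1+j)
...   | t , eq = trans (cong (λ u → nth a (G u) j) eq) (nth-G-++ (Fpow M [ ⁰ ]) t j<GM)

factor⇒occurs : ∀ u → IsFactor u w5 → ∃ λ M → ∃₂ λ α β → G (Fpow M [ ⁰ ]) ≡ α ++ u ++ β
factor⇒occurs u (i , slice≡u) = M , take i W , drop L (drop i W) , (begin
  W                                                   ≡⟨ take++drop≡id i W ⟨
  take i W ++ drop i W                                ≡⟨ cong (take i W ++_) (take++drop≡id L (drop i W)) ⟨
  take i W ++ take L (drop i W) ++ drop L (drop i W)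
    ≡⟨ cong (λ v → take i W ++ v ++ drop L (drop i W)) (trans (sym window) slice≡u) ⟩
  take i W ++ u ++ drop L (drop i W)                  ∎)
  where
  L M : ℕ
  L = length u
  M = L + i
  W : List Letter
  W = G (Fpow M [ ⁰ ])
  window : slice w5 i L ≡ take L (drop i W)
  window = slice-≡-take-drop a w5 W (w5-nth M) L i (<⇒≤ (length-G-Fpow-⁰ M))

T0324-not-factor : ∀ n → ¬ IsFactor (T0324 n) w5
T0324-not-factor n factor =
  let M , α , β , eq = factor⇒occurs (T0324 n) factor
      α′ , x , β′ , x∈34 , eq′ = Gᴿ.desubstitute g-synchronizing g-separating g-forcesLast (λ ()) g-forcesFirst
        (Fpow M [ ⁰ ]) α (core n) β
        (trans eq (trans (cong (λ u → α ++ u ++ β) (T0324-core n))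
                         (cong (λ u → α ++ g³-suffix ++ u) (++-assoc (G (core n)) g³-prefix β))))
  in core-not-bracketed n M α′ x β′ x∈34 eq′

mainTheorem4 : (n : ℕ) →
    IsConjugate (T0324 n) (G (Fpow n w0324)) × ¬ IsFactor (T0324 n) w5
mainTheorem4 n = T0324-conjugate n , T0324-not-factor n
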